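{- Let $H=(V,E)$ be a hypergraph such that the degree of each vertex and the cardinality of each edge are even. If $e$ is a cut edge of $H$, then every connected component of $H-e$ contains an even number of vertices of $e$. In particular, $H$ has no strong cut edges.
   Context: A hypergraph $H=(V,E)$ consists of a nonempty finite vertex set $V$, a finite edge set $E$, and an incidence function $\psi:E\to 2^V$; edges are identified with their vertex sets (parallel edges allowed). The degree of a vertex is the number of edges containing it. Two distinct vertices are adjacent via $e$ if both lie in $e$; a walk is a sequence $v_0e_1v_1\dots e_kv_k$ with $v_{i-1},v_i$ adjacent via $e_i$. For an equivalence class $V'$ of "joined by a walk", the connected component is $(V',\{f\in E:\emptyset\ne f\subseteq V'\})$; $\omega(H)$ is the number of components. $H-e=(V,E\setminus\{e\})$. An edge $e$ is a cut edge if $\omega(H-e)>\omega(H)$, and a strong cut edge if moreover $\omega(H-e)=\omega(H)+|e|-1$. -}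

module Defs where

open import Data.Nat using (ℕ; zero; suc)
open import Data.Fin using (Fin; punchIn)
open import Data.Fin.Subset using (Subset; _∈_; _⊆_; ∣_∣)
open import Data.Fin.Subset.Properties using (_∈?_)
open import Data.List using (List; length; filter; allFin)
open import Data.Product using (Σ; ∃; _×_)
open import Relation.Binary.PropositionalEquality using (_≡_; _≢_)
open import Relation.Nullary using (¬_)

-- A hypergraph on the vertex set Fin n: a finite edge set Fin m with an
-- incidence function ψ : E → 2^V (parallel edges allowed).
record Hypergraph (n : ℕ) : Set where
  constructor hypergraph
  field
    m : ℕ
    ψ : Fin m → Subset n
open Hypergraph public

degree : ∀ {n} → Hypergraph n → Fin n → ℕ
degree H v = length (filter (λ j → v ∈? ψ H j) (allFin (m H)))

delete : ∀ {n m} → (Fin m → Subset n) → Fin m → Hypergraph n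
delete {m = suc k} ψ e = hypergraph k (λ j → ψ (punchIn e j))

_-ₑ_ : ∀ {n} (H : Hypergraph n) → Fin (m H) → Hypergraph n
H -ₑ e = delete (ψ H) e

Adjacent : ∀ {n} (H : Hypergraph n) → Fin (m H) → Fin n → Fin n → Set
Adjacent H i u w = u ≢ w × u ∈ ψ H i × w ∈ ψ H i

data Walk {n} (H : Hypergraph n) : Fin n → Fin n → Set where
  [] : ∀ {u} → Walk H u u
  step : ∀ {u w v} (i : Fin (m H)) → Adjacent H i u w → Walk H w v → Walk H u v

Joined : ∀ {n} → Hypergraph n → Fin n → Fin n → Set
Joined H u v = Walk H u v

-- ω(H) ≡ k: the equivalence classes of Joined are exactly k in number,
-- witnessed by k pairwise non-joined representatives covering all vertices.
ComponentCount : ∀ {n} → Hypergraph n → ℕ → Set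
ComponentCount {n} H k =
  Σ (Fin k → Fin n) λ r →
    (∀ i j → i ≢ j → ¬ Joined H (r i) (r j)) ×
    (∀ v → ∃ λ i → Joined H (r i) v)

-- Fix a component C of H − e and count incidences between the edges of H and C:
-- the sum over all edges f of |f ∩ C| equals the sum of the degrees of the vertices
-- of C, hence is even; an edge f ≠ e lies in a single component of H − e, so
-- |f ∩ C| ∈ {0, |f|} is even too, and therefore so is |e ∩ C|.
-- For the second claim let e have s ≥ 1 vertices. The components of H − e meeting e
-- each contain at least two of them, so there are p ≤ s/2 of them, and they all lie in
-- the component of H containing e; every other component of H − e is a component of H.
-- Hence ω(H − e) ≤ ω(H) + p − 1 < ω(H) + s − 1.

module Submission where

open import Defs
open import Algebra.Properties.Semiring.Sum using ()
open import Data.Bool using (Bool; true; false; _∧_)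
open import Data.Empty using (⊥-elim)
open import Data.Fin using (Fin; zero; suc; punchIn; punchOut)
open import Data.Fin.Properties using (_≟_; punchIn-punchOut; punchInᵢ≢i)
open import Data.Fin.Subset using (Subset; _∈_; ∣_∣; _∩_; ⊥; ⊤; ⁅_⁆; Empty)
open import Data.Fin.Subset.Properties
  using (_∈?_; nonempty?; Empty-unique; ⊆-antisym; p∩q⊆p; x∈p∩q⁺; x∈p∩q⁻; ∣⊥∣≡0; ∣⊤∣≡n;
         ∩-identityˡ; ∣⁅x⁆∣≡1; x∈⁅x⁆; x∈⁅y⁆⇒x≡y; p⊆q⇒∣p∣≤∣q∣)
open import Data.List as List using (filter; length)
open import Data.Nat using (ℕ; zero; suc; _+_; _*_; _∸_; _<_; _≤_; z≤n; >-nonZero)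
open import Data.Nat.Divisibility using (_∣_; _∣0; ∣m∣n⇒∣m+n; ∣m⇒∣m*n; ∣m+n∣m⇒∣n; ∣⇒≤)
open import Data.Nat.Properties
  using (+-*-semiring; +-comm; +-identityʳ; *-identityʳ; *-zeroʳ; *-suc; ≤-reflexive; ≤-trans;
         m≤n+m; +-mono-≤; +-monoʳ-≤; +-monoʳ-<; n<1+n; +-cancelˡ-≤; m∸n+n≡m; m∸n≤m; <⇒≱;
         module ≤-Reasoning)
open import Data.Product using (Σ; _,_; _×_; ∃; proj₁; proj₂)
import Data.Product as Prod
open import Data.Sum using (_⊎_; inj₁; inj₂; [_,_]′)
import Data.Sum as Sum
open import Data.Vec using (_∷_; []; lookup; tabulate; here; there)
open import Data.Vec.Properties using (lookup-zipWith; lookup∘tabulate; lookup⇒[]=; []=⇒lookup)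
open import Function using (_∘_; id)
open import Function.Bundles using (_⇔_; mk⇔)
open import Relation.Binary.PropositionalEquality
  using (_≡_; _≢_; refl; cong; sym; trans; subst; module ≡-Reasoning)
open import Relation.Nullary using (¬_; yes; no; does)
open import Relation.Nullary.Decidable using (dec-true)
open import Relation.Unary using (Decidable)

open Algebra.Properties.Semiring.Sum +-*-semiring

𝟙 : Bool → ℕ
𝟙 false = 0
𝟙 true  = 1

𝟙-∧ : ∀ a b → 𝟙 (a ∧ b) ≡ 𝟙 a * 𝟙 b
𝟙-∧ false b = refl
𝟙-∧ true  b = sym (+-identityʳ (𝟙 b))

∑-mono-≤ : ∀ {a} {f g : Fin a → ℕ} → (∀ i → f i ≤ g i) → sum f ≤ sum g
∑-mono-≤ {zero}  _   = z≤n
∑-mono-≤ {suc a} f≤g = +-mono-≤ (f≤g zero) (∑-mono-≤ (f≤g ∘ suc))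

∑-even : ∀ {a} (f : Fin a → ℕ) → (∀ i → 2 ∣ f i) → 2 ∣ sum f
∑-even {zero}  f _    = 2 ∣0
∑-even {suc a} f even = ∣m∣n⇒∣m+n (even zero) (∑-even (f ∘ suc) (even ∘ suc))

∑-𝟙-≟ : ∀ {k} (x : Fin k) → ∑[ t < k ] 𝟙 (does (x ≟ t)) ≡ 1
∑-𝟙-≟ {suc k} zero    = cong suc (sum-replicate-zero k)
∑-𝟙-≟ {suc k} (suc x) = ∑-𝟙-≟ x

∣p∣≡∑𝟙 : ∀ {n} (p : Subset n) → ∣ p ∣ ≡ ∑[ v < n ] 𝟙 (lookup p v)
∣p∣≡∑𝟙 []          = refl
∣p∣≡∑𝟙 (true  ∷ p) = cong suc (∣p∣≡∑𝟙 p)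
∣p∣≡∑𝟙 (false ∷ p) = ∣p∣≡∑𝟙 p

∣p∩q∣≡∑𝟙*𝟙 : ∀ {n} (p q : Subset n) → ∣ p ∩ q ∣ ≡ ∑[ v < n ] (𝟙 (lookup p v) * 𝟙 (lookup q v))
∣p∩q∣≡∑𝟙*𝟙 p q = trans (∣p∣≡∑𝟙 (p ∩ q)) (sum-cong-≗ λ v →
  trans (cong 𝟙 (lookup-zipWith _∧_ v p q)) (𝟙-∧ (lookup p v) (lookup q v)))

fibre : ∀ {a b} → (Fin a → Fin b) → Fin b → Subset a
fibre c t = tabulate (λ v → does (c v ≟ t))

∈-fibre⁻ : ∀ {a b} (c : Fin a → Fin b) {t x} → x ∈ fibre c t → c x ≡ t
∈-fibre⁻ c {t} {x} x∈ with c x ≟ t | trans (sym (lookup∘tabulate _ x)) ([]=⇒lookup x∈)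
... | yes cx≡t | _  = cx≡t
... | no  _    | ()

∈-fibre⁺ : ∀ {a b} (c : Fin a → Fin b) {t x} → c x ≡ t → x ∈ fibre c t
∈-fibre⁺ c {t} {x} cx≡t = lookup⇒[]= x _ (trans (lookup∘tabulate _ x) (dec-true (c x ≟ t) cx≡t))

∣p∣≡∑∣p∩fibre∣ : ∀ {a b} (c : Fin a → Fin b) (p : Subset a) →
  ∣ p ∣ ≡ ∑[ t < b ] ∣ p ∩ fibre c t ∣
∣p∣≡∑∣p∩fibre∣ {a} {b} c p = begin
  ∣ p ∣                                                  ≡⟨ ∣p∣≡∑𝟙 p ⟩
  ∑[ v < a ] 𝟙 (p′ v)                                    ≡⟨ sum-cong-≗ (λ v → sym (*-identityʳ (𝟙 (p′ v)))) ⟩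
  ∑[ v < a ] (𝟙 (p′ v) * 1)                              ≡⟨ sum-cong-≗ (λ v → cong (𝟙 (p′ v) *_) (sym (∑-𝟙-≟ (c v)))) ⟩
  ∑[ v < a ] (𝟙 (p′ v) * ∑[ t < b ] 𝟙 (does (c v ≟ t)))  ≡⟨ sum-cong-≗ (λ v → *-distribˡ-sum (𝟙 (p′ v)) (λ t → 𝟙 (does (c v ≟ t)))) ⟩
  ∑[ v < a ] ∑[ t < b ] (𝟙 (p′ v) * 𝟙 (does (c v ≟ t))) ≡⟨ ∑-comm (λ v t → 𝟙 (p′ v) * 𝟙 (does (c v ≟ t))) ⟩
  ∑[ t < b ] ∑[ v < a ] (𝟙 (p′ v) * 𝟙 (does (c v ≟ t))) ≡⟨ sum-cong-≗ (λ t → sym (∣p∩fibre∣ t)) ⟩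
  ∑[ t < b ] ∣ p ∩ fibre c t ∣                           ∎
  where
  open ≡-Reasoning
  p′ = lookup p
  ∣p∩fibre∣ : ∀ t → ∣ p ∩ fibre c t ∣ ≡ ∑[ v < a ] (𝟙 (p′ v) * 𝟙 (does (c v ≟ t)))
  ∣p∩fibre∣ t = trans (∣p∩q∣≡∑𝟙*𝟙 p (fibre c t))
    (sum-cong-≗ λ v → cong (λ b → 𝟙 (p′ v) * 𝟙 b) (lookup∘tabulate _ v))

fibre-∩-constant : ∀ {a b} (c : Fin a → Fin b) (p : Subset a) t →
  (∀ {x y} → x ∈ p → y ∈ p → c x ≡ c y) →
  p ∩ fibre c t ≡ ⊥ ⊎ p ∩ fibre c t ≡ p
fibre-∩-constant c p t constant with nonempty? (p ∩ fibre c t)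
... | no  empty        = inj₁ (Empty-unique empty)
... | yes (x , x∈p∩C) = inj₂ (⊆-antisym (p∩q⊆p p _) λ y∈p →
        x∈p∩q⁺ (y∈p , ∈-fibre⁺ c (trans (constant y∈p x∈p) (∈-fibre⁻ c x∈C))))
  where
  x∈p = proj₁ (x∈p∩q⁻ p _ x∈p∩C)
  x∈C = proj₂ (x∈p∩q⁻ p _ x∈p∩C)

does-∈? : ∀ {n} (v : Fin n) (p : Subset n) → does (v ∈? p) ≡ lookup p v
does-∈? zero    (true  ∷ p) = refl
does-∈? zero    (false ∷ p) = refl
does-∈? (suc v) (_     ∷ p) = does-∈? v p

length-filter-tabulate : ∀ {A : Set} {P : A → Set} (P? : Decidable P) {a} (f : Fin a → A) →
  length (filter P? (List.tabulate f)) ≡ ∑[ i < a ] 𝟙 (does (P? (f i)))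
length-filter-tabulate P? {zero}  f = refl
length-filter-tabulate P? {suc a} f with does (P? (f zero))
... | true  = cong suc (length-filter-tabulate P? (f ∘ suc))
... | false = length-filter-tabulate P? (f ∘ suc)

degree≡∑𝟙 : ∀ {n} (H : Hypergraph n) v → degree H v ≡ ∑[ i < m H ] 𝟙 (lookup (ψ H i) v)
degree≡∑𝟙 H v = trans (length-filter-tabulate (λ i → v ∈? ψ H i) (λ i → i))
  (sum-cong-≗ λ i → cong 𝟙 (does-∈? v (ψ H i)))

∑∣ψ∩C∣≡∑degree : ∀ {n} (H : Hypergraph n) (C : Subset n) →
  ∑[ i < m H ] ∣ ψ H i ∩ C ∣ ≡ ∑[ v < n ] (degree H v * 𝟙 (lookup C v))
∑∣ψ∩C∣≡∑degree {n} H C = begin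
  ∑[ i < m H ] ∣ ψ H i ∩ C ∣                       ≡⟨ sum-cong-≗ (λ i → ∣p∩q∣≡∑𝟙*𝟙 (ψ H i) C) ⟩
  ∑[ i < m H ] ∑[ v < n ] (𝟙 (ψ′ i v) * 𝟙 (C′ v))  ≡⟨ ∑-comm (λ i v → 𝟙 (ψ′ i v) * 𝟙 (C′ v)) ⟩
  ∑[ v < n ] ∑[ i < m H ] (𝟙 (ψ′ i v) * 𝟙 (C′ v))  ≡⟨ sum-cong-≗ (λ v → sym (*-distribʳ-sum (𝟙 (C′ v)) (λ i → 𝟙 (ψ′ i v)))) ⟩
  ∑[ v < n ] (∑[ i < m H ] 𝟙 (ψ′ i v) * 𝟙 (C′ v))  ≡⟨ sum-cong-≗ (λ v → cong (_* 𝟙 (C′ v)) (sym (degree≡∑𝟙 H v))) ⟩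
  ∑[ v < n ] (degree H v * 𝟙 (C′ v))               ∎
  where
  open ≡-Reasoning
  ψ′ = λ i → lookup (ψ H i)
  C′ = lookup C

even-degree⇒∑∣ψ∩C∣-even : ∀ {n} (H : Hypergraph n) (C : Subset n) → (∀ v → 2 ∣ degree H v) →
  2 ∣ ∑[ i < m H ] ∣ ψ H i ∩ C ∣
even-degree⇒∑∣ψ∩C∣-even H C even = subst (2 ∣_) (sym (∑∣ψ∩C∣≡∑degree H C))
  (∑-even _ λ v → ∣m⇒∣m*n (𝟙 (lookup C v)) (even v))

∑∣fibre∣≡size : ∀ {a b} (c : Fin a → Fin b) → ∑[ t < b ] ∣ fibre c t ∣ ≡ a
∑∣fibre∣≡size {a} {b} c = begin
  ∑[ t < b ] ∣ fibre c t ∣      ≡⟨ sum-cong-≗ (λ t → cong ∣_∣ (sym (∩-identityˡ (fibre c t)))) ⟩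
  ∑[ t < b ] ∣ ⊤ ∩ fibre c t ∣  ≡⟨ sym (∣p∣≡∑∣p∩fibre∣ c ⊤) ⟩
  ∣ ⊤ {a} ∣                     ≡⟨ ∣⊤∣≡n a ⟩
  a                             ∎
  where open ≡-Reasoning

Empty⇒∣p∣≡0 : ∀ {n} {p : Subset n} → Empty p → ∣ p ∣ ≡ 0
Empty⇒∣p∣≡0 {n} empty = trans (cong ∣_∣ (Empty-unique empty)) (∣⊥∣≡0 n)

x∈p⇒0<∣p∣ : ∀ {n x} {p : Subset n} → x ∈ p → 0 < ∣ p ∣
x∈p⇒0<∣p∣ {x = x} {p} x∈p = subst (_≤ ∣ p ∣) (∣⁅x⁆∣≡1 x)
  (p⊆q⇒∣p∣≤∣q∣ λ y∈⁅x⁆ → subst (_∈ p) (sym (x∈⁅y⁆⇒x≡y x y∈⁅x⁆)) x∈p)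

subsingleton⇒∣p∣≤1 : ∀ {n} (p : Subset n) → (∀ {x y} → x ∈ p → y ∈ p → x ≡ y) → ∣ p ∣ ≤ 1
subsingleton⇒∣p∣≤1 p unique with nonempty? p
... | no  empty      = subst (_≤ 1) (sym (Empty⇒∣p∣≡0 empty)) z≤n
... | yes (x , x∈p) = subst (∣ p ∣ ≤_) (∣⁅x⁆∣≡1 x)
  (p⊆q⇒∣p∣≤∣q∣ λ y∈p → subst (_∈ ⁅ x ⁆) (unique x∈p y∈p) (x∈⁅x⁆ x))

*∣p∣≤sum : ∀ {a} c (p : Subset a) (f : Fin a → ℕ) → (∀ {i} → i ∈ p → c ≤ f i) → c * ∣ p ∣ ≤ sum f
*∣p∣≤sum c []          f _     = ≤-reflexive (*-zeroʳ c)
*∣p∣≤sum c (true  ∷ p) f c≤f = subst (_≤ sum f) (sym (*-suc c ∣ p ∣))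
  (+-mono-≤ (c≤f here) (*∣p∣≤sum c p (f ∘ suc) (c≤f ∘ there)))
*∣p∣≤sum c (false ∷ p) f c≤f = ≤-trans (*∣p∣≤sum c p (f ∘ suc) (c≤f ∘ there)) (m≤n+m _ (f zero))

sum<pivot+size : ∀ {k} (f : Fin k → ℕ) t₀ → (∀ t → t ≢ t₀ → f t ≤ 1) → sum f < f t₀ + k
sum<pivot+size {suc k} f t₀ f≤1 = begin-strict
  sum f                               ≡⟨ sum-remove {i = t₀} f ⟩
  f t₀ + ∑[ t < k ] f (punchIn t₀ t)  ≤⟨ +-monoʳ-≤ (f t₀) (∑-mono-≤ (λ t → f≤1 _ (punchInᵢ≢i t₀ t))) ⟩
  f t₀ + ∑[ t < k ] 1                 ≡⟨ cong (f t₀ +_) (∑-1 k) ⟩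
  f t₀ + k                            <⟨ +-monoʳ-< (f t₀) (n<1+n k) ⟩
  f t₀ + suc k                        ∎
  where
  open ≤-Reasoning
  ∑-1 : ∀ k → ∑[ t < k ] 1 ≡ k
  ∑-1 zero    = refl
  ∑-1 (suc k) = cong suc (∑-1 k)

strong-cut-arithmetic : ∀ {k k′ p s} → k′ < p + k → 2 * p ≤ s → 0 < s → k′ ≢ k + s ∸ 1
strong-cut-arithmetic {k} {k′} {p} {s} k′<p+k 2p≤s 0<s k′≡ = <⇒≱ 0<s (≤-trans s≤p p≤0)
  where
  open ≤-Reasoning
  s≤p : s ≤ p
  s≤p = +-cancelˡ-≤ k s p (begin
    k + s          ≡⟨ sym (m∸n+n≡m (≤-trans 0<s (m≤n+m s k))) ⟩
    k + s ∸ 1 + 1  ≡⟨ cong (_+ 1) (sym k′≡) ⟩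
    k′ + 1         ≡⟨ +-comm k′ 1 ⟩
    suc k′         ≤⟨ k′<p+k ⟩
    p + k          ≡⟨ +-comm p k ⟩
    k + p          ∎)
  p≤0 : p ≤ 0
  p≤0 = +-cancelˡ-≤ p p 0 (begin
    p + p          ≡⟨ cong (p +_) (sym (+-identityʳ p)) ⟩
    2 * p          ≤⟨ 2p≤s ⟩
    s              ≤⟨ s≤p ⟩
    p              ≡⟨ sym (+-identityʳ p) ⟩
    p + 0          ∎)

module _ {n} {H : Hypergraph n} where

  _++ʷ_ : ∀ {u w v} → Walk H u w → Walk H w v → Walk H u v
  []             ++ʷ q = q
  step i adj p ++ʷ q = step i adj (p ++ʷ q)

  reverseʷ : ∀ {u v} → Walk H u v → Walk H v u
  reverseʷ []                             = []
  reverseʷ (step i (u≢w , u∈i , w∈i) p) = reverseʷ p ++ʷ step i (u≢w ∘ sym , w∈i , u∈i) []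

  edge⇒joined : ∀ {i x y} → x ∈ ψ H i → y ∈ ψ H i → Joined H x y
  edge⇒joined {i} {x} {y} x∈i y∈i with x ≟ y
  ... | yes refl = []
  ... | no  x≢y  = step i (x≢y , x∈i , y∈i) []

module ComponentLabelling {n} {H : Hypergraph n} {k} (cc : ComponentCount H k) where

  rep : Fin k → Fin n
  rep = proj₁ cc

  label : Fin n → Fin k
  label v = proj₁ (proj₂ (proj₂ cc) v)

  rep-walk : ∀ v → Walk H (rep (label v)) v
  rep-walk v = proj₂ (proj₂ (proj₂ cc) v)

  private
    separated : ∀ i j → i ≢ j → ¬ Joined H (rep i) (rep j)
    separated = proj₁ (proj₂ cc)

  joined⇒label≡ : ∀ {x y} → Joined H x y → label x ≡ label y
  joined⇒label≡ {x} {y} p with label x ≟ label y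
  ... | yes eq  = eq
  ... | no  neq = ⊥-elim (separated _ _ neq ((rep-walk x ++ʷ p) ++ʷ reverseʷ (rep-walk y)))

  label≡⇒joined : ∀ {x y} → label x ≡ label y → Joined H x y
  label≡⇒joined {x} {y} eq =
    reverseʷ (rep-walk x) ++ʷ subst (λ t → Walk H (rep t) y) (sym eq) (rep-walk y)

  label-rep : ∀ t → label (rep t) ≡ t
  label-rep t with label (rep t) ≟ t
  ... | yes eq  = eq
  ... | no  neq = ⊥-elim (separated _ _ neq (rep-walk (rep t)))

  ∣edge∩component∣-even : ∀ i t → 2 ∣ ∣ ψ H i ∣ → 2 ∣ ∣ ψ H i ∩ fibre label t ∣
  ∣edge∩component∣-even i t even
    with fibre-∩-constant label (ψ H i) t (λ x∈i y∈i → joined⇒label≡ (edge⇒joined x∈i y∈i))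
  ... | inj₁ ≡⊥ = subst (2 ∣_) (sym (trans (cong ∣_∣ ≡⊥) (∣⊥∣≡0 n))) (2 ∣0)
  ... | inj₂ ≡p = subst (2 ∣_) (sym (cong ∣_∣ ≡p)) even

module Deletion {n m} (ψ₀ : Fin (suc m) → Subset n) (e : Fin (suc m)) where

  H : Hypergraph n
  H = hypergraph (suc m) ψ₀

  G : Hypergraph n
  G = H -ₑ e

  embed : ∀ {u v} → Walk G u v → Walk H u v
  embed []             = []
  embed (step j adj p) = step (punchIn e j) adj (embed p)

  lift : ∀ {u v} → Walk H u v → Walk G u v ⊎ ∃ λ x → x ∈ ψ₀ e × Walk G u x
  lift [] = inj₁ []
  lift {u} (step i adj p) with e ≟ i
  ... | yes refl = inj₂ (u , proj₁ (proj₂ adj) , [])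
  ... | no  e≢i  = Sum.map (step j adj′) (Prod.map₂ (Prod.map₂ (step j adj′))) (lift p)
    where
    j    = punchOut e≢i
    adj′ = subst (λ i → Adjacent H i _ _) (sym (punchIn-punchOut e≢i)) adj

  module _ (even-degree : ∀ v → 2 ∣ degree H v) (even-edge : ∀ i → 2 ∣ ∣ ψ₀ i ∣)
           {k′} (ccG : ComponentCount G k′) where

    open ComponentLabelling ccG using () renaming
      (label to labelᴳ; rep to repᴳ; label-rep to labelᴳ-repᴳ; joined⇒label≡ to joinedᴳ⇒labelᴳ≡;
       label≡⇒joined to labelᴳ≡⇒joinedᴳ; ∣edge∩component∣-even to ∣edgeᴳ∩component∣-even)

    -- Double counting over the edges of H: the edges of G meet each component evenly, so e does too.
    ∣e∩component∣-even : ∀ t → 2 ∣ ∣ ψ₀ e ∩ fibre labelᴳ t ∣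
    ∣e∩component∣-even t = ∣m+n∣m⇒∣n (subst (2 ∣_) split (even-degree⇒∑∣ψ∩C∣-even H C even-degree))
      (∑-even _ λ j → ∣edgeᴳ∩component∣-even j t (even-edge (punchIn e j)))
      where
      C = fibre labelᴳ t
      split : ∑[ i < suc m ] ∣ ψ₀ i ∩ C ∣ ≡ ∑[ j < m ] ∣ ψ₀ (punchIn e j) ∩ C ∣ + ∣ ψ₀ e ∩ C ∣
      split = trans (sum-remove {i = e} (λ i → ∣ ψ₀ i ∩ C ∣)) (+-comm ∣ ψ₀ e ∩ C ∣ _)

    e∩component-even : ∀ u → Σ (Subset n) λ S →
      (∀ v → (v ∈ S) ⇔ (v ∈ ψ₀ e × Joined G u v)) × 2 ∣ ∣ S ∣
    e∩component-even u = ψ₀ e ∩ C , (λ v → mk⇔ to from) , ∣e∩component∣-even (labelᴳ u)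
      where
      C = fibre labelᴳ (labelᴳ u)
      to : ∀ {v} → v ∈ ψ₀ e ∩ C → v ∈ ψ₀ e × Joined G u v
      to v∈e∩C = let (v∈e , v∈C) = x∈p∩q⁻ (ψ₀ e) C v∈e∩C in
        v∈e , labelᴳ≡⇒joinedᴳ (sym (∈-fibre⁻ labelᴳ v∈C))
      from : ∀ {v} → v ∈ ψ₀ e × Joined G u v → v ∈ ψ₀ e ∩ C
      from (v∈e , walk) = x∈p∩q⁺ (v∈e , ∈-fibre⁺ labelᴳ (sym (joinedᴳ⇒labelᴳ≡ walk)))

    module _ {k} (ccH : ComponentCount H k) where

      open ComponentLabelling ccH using () renaming
        (label to labelᴴ; joined⇒label≡ to joinedᴴ⇒labelᴴ≡; label≡⇒joined to labelᴴ≡⇒joinedᴴ)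

      labelᴴ≡⇒labelᴳ≡⊎meets-e : ∀ {x y} → labelᴴ x ≡ labelᴴ y →
        labelᴳ x ≡ labelᴳ y ⊎ ∃ λ z → z ∈ ψ₀ e × labelᴳ x ≡ labelᴳ z
      labelᴴ≡⇒labelᴳ≡⊎meets-e eq =
        Sum.map joinedᴳ⇒labelᴳ≡ (Prod.map₂ (Prod.map₂ joinedᴳ⇒labelᴳ≡)) (lift (labelᴴ≡⇒joinedᴴ eq))

      labelᴳ≡⇒labelᴴ≡ : ∀ {x y} → labelᴳ x ≡ labelᴳ y → labelᴴ x ≡ labelᴴ y
      labelᴳ≡⇒labelᴴ≡ eq = joinedᴴ⇒labelᴴ≡ (embed (labelᴳ≡⇒joinedᴳ eq))

      module _ {x₀} (x₀∈e : x₀ ∈ ψ₀ e) where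

        φ : Fin k′ → Fin k
        φ j = labelᴴ (repᴳ j)

        t₀ : Fin k
        t₀ = labelᴴ x₀

        fibre-t₀⇒2≤∣e∩component∣ : ∀ {j} → j ∈ fibre φ t₀ → 2 ≤ ∣ ψ₀ e ∩ fibre labelᴳ j ∣
        fibre-t₀⇒2≤∣e∩component∣ {j} j∈ = ∣⇒≤ ⦃ >-nonZero 0<∣e∩C∣ ⦄ (∣e∩component∣-even j)
          where
          meets : ∃ λ z → z ∈ ψ₀ e × labelᴳ (repᴳ j) ≡ labelᴳ z
          meets = [ (λ eq → x₀ , x₀∈e , eq) , id ]′
                    (labelᴴ≡⇒labelᴳ≡⊎meets-e (∈-fibre⁻ φ j∈))
          0<∣e∩C∣ : 0 < ∣ ψ₀ e ∩ fibre labelᴳ j ∣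
          0<∣e∩C∣ = let (z , z∈e , eq) = meets in
            x∈p⇒0<∣p∣ (x∈p∩q⁺ (z∈e , ∈-fibre⁺ labelᴳ (trans (sym eq) (labelᴳ-repᴳ j))))

        other-fibres-subsingleton : ∀ {t} → t ≢ t₀ → ∀ {i j} → i ∈ fibre φ t → j ∈ fibre φ t → i ≡ j
        other-fibres-subsingleton {t} t≢t₀ {i} {j} i∈ j∈
          with labelᴴ≡⇒labelᴳ≡⊎meets-e (trans (∈-fibre⁻ φ i∈) (sym (∈-fibre⁻ φ j∈)))
        ... | inj₁ eq            = trans (sym (labelᴳ-repᴳ i)) (trans eq (labelᴳ-repᴳ j))
        ... | inj₂ (z , z∈e , eq) = ⊥-elim (t≢t₀ (begin
          t                 ≡⟨ sym (∈-fibre⁻ φ i∈) ⟩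
          labelᴴ (repᴳ i)   ≡⟨ labelᴳ≡⇒labelᴴ≡ eq ⟩
          labelᴴ z          ≡⟨ joinedᴴ⇒labelᴴ≡ (edge⇒joined {i = e} z∈e x₀∈e) ⟩
          t₀                ∎))
          where open ≡-Reasoning

        k′<∣fibre-t₀∣+k : k′ < ∣ fibre φ t₀ ∣ + k
        k′<∣fibre-t₀∣+k = subst (_< ∣ fibre φ t₀ ∣ + k) (∑∣fibre∣≡size φ)
          (sum<pivot+size (λ t → ∣ fibre φ t ∣) t₀
            (λ t t≢t₀ → subsingleton⇒∣p∣≤1 (fibre φ t) (other-fibres-subsingleton t≢t₀)))

        2*∣fibre-t₀∣≤∣e∣ : 2 * ∣ fibre φ t₀ ∣ ≤ ∣ ψ₀ e ∣
        2*∣fibre-t₀∣≤∣e∣ = subst (2 * ∣ fibre φ t₀ ∣ ≤_) (sym (∣p∣≡∑∣p∩fibre∣ labelᴳ (ψ₀ e)))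
          (*∣p∣≤sum 2 (fibre φ t₀) (λ j → ∣ ψ₀ e ∩ fibre labelᴳ j ∣) fibre-t₀⇒2≤∣e∩component∣)

        k′≢k+∣e∣∸1 : k′ ≢ k + ∣ ψ₀ e ∣ ∸ 1
        k′≢k+∣e∣∸1 = strong-cut-arithmetic {k} {p = ∣ fibre φ t₀ ∣}
          k′<∣fibre-t₀∣+k 2*∣fibre-t₀∣≤∣e∣ (x∈p⇒0<∣p∣ x₀∈e)

      not-strong-cut : ¬ (k < k′ × k′ ≡ k + ∣ ψ₀ e ∣ ∸ 1)
      not-strong-cut (k<k′ , k′≡) with nonempty? (ψ₀ e)
      ... | yes (_ , x₀∈e) = k′≢k+∣e∣∸1 x₀∈e k′≡
      ... | no empty = <⇒≱ k<k′ (begin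
        k′                   ≡⟨ k′≡ ⟩
        k + ∣ ψ₀ e ∣ ∸ 1     ≡⟨ cong (λ s → k + s ∸ 1) (Empty⇒∣p∣≡0 empty) ⟩
        k + 0 ∸ 1            ≤⟨ m∸n≤m (k + 0) 1 ⟩
        k + 0                ≡⟨ +-identityʳ k ⟩
        k                    ∎)
        where open ≤-Reasoning

-- The first part does not need e to be a cut edge.
theorem3p22 : (n : ℕ) (H : Hypergraph (suc n)) →
    (∀ v → 2 ∣ degree H v) →
    (∀ f → 2 ∣ ∣ ψ H f ∣) →
    ((e : Fin (m H)) (k k′ : ℕ) → ComponentCount H k → ComponentCount (H -ₑ e) k′ → k < k′ →
      (u : Fin (suc n)) →
        Σ (Subset (suc n)) λ S →
          (∀ v → (v ∈ S) ⇔ (v ∈ ψ H e × Joined (H -ₑ e) u v)) × 2 ∣ ∣ S ∣)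
    × ((e : Fin (m H)) (k k′ : ℕ) → ComponentCount H k → ComponentCount (H -ₑ e) k′ →
      ¬ (k < k′ × k′ ≡ k + ∣ ψ H e ∣ ∸ 1))
theorem3p22 n (hypergraph zero ψ₀) _ _ = (λ ()) , (λ ())
theorem3p22 n (hypergraph (suc m) ψ₀) even-degree even-edge =
  (λ e _ _ _ ccG _ → e∩component-even ψ₀ e even-degree even-edge ccG) ,
  (λ e _ _ ccH ccG → not-strong-cut ψ₀ e even-degree even-edge ccG ccH)
  where open Deletion
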